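{- Let $n\ge2$ be an integer and let $A_{ij}$ be the coefficient of $u^iv^jw^{2n-i-j}$ in the numerator $P_{n/(n+1)}(u,v,w)$ of the Markov polynomial $M_{n/(n+1)}$. Then $A_{m,\,n+1-m}=4m$ for every $m=1,2,\dots,n-1$.
   Context: Markov polynomials $M_\rho(x,y,z)$, $\rho\in\mathbb{Q}_{\ge0}\cup\{1/0\}$, are defined recursively by $M_{0/1}=x$, $M_{1/0}=y$, $M_{1/1}=(x^2+y^2)/z$, and: whenever $p/q$, $r/s$ are fractions in lowest terms with $p,q,r,s\ge0$, $qr-ps=1$, mediant $\mu=(p+r)/(q+s)$, then $M_{(2p+r)/(2q+s)}=(M_{p/q}^2+M_\mu^2)/M_{r/s}$ and $M_{(p+2r)/(q+2s)}=(M_\mu^2+M_{r/s}^2)/M_{p/q}$. For coprime positive $a,b$, $M_{a/b}=P_{a/b}(x^2,y^2,z^2)/(x^{a-1}y^{b-1}z^{a+b-1})$ with $P_{a/b}(u,v,w)$ homogeneous of degree $a+b-1$ (the numerator). -}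

module Defs where

open import Data.Nat using (ℕ; zero; suc; _∸_; _≡ᵇ_) renaming (_+_ to _+ℕ_; _*_ to _*ℕ_)
open import Data.Integer using (ℤ; +_) renaming (_+_ to _+ℤ_; _*_ to _*ℤ_)
open import Data.Bool using (Bool; true; false; if_then_else_; _∧_)
open import Data.List using (List; []; _∷_; _++_; map; concatMap; foldr)
open import Data.Product using (_×_; _,_; proj₁; proj₂)
open import Relation.Binary.PropositionalEquality using (_≡_)

-- Polynomials in three variables (x,y,z  resp.  u,v,w) with integer
-- coefficients, represented as (unnormalised) lists of terms
--   (c , i , j , k)  meaning  c · x^i y^j z^k.

Term : Set
Term = ℤ × ℕ × ℕ × ℕ

Poly : Set
Poly = List Term

coeff : Poly → ℕ → ℕ → ℕ → ℤ
coeff p i j k = foldr step (+ 0) p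
  where
  step : Term → ℤ → ℤ
  step (c , a , b , d) acc =
    if (a ≡ᵇ i) ∧ (b ≡ᵇ j) ∧ (d ≡ᵇ k) then c +ℤ acc else acc

_≈_ : Poly → Poly → Set
p ≈ q = ∀ i j k → coeff p i j k ≡ coeff q i j k

infix 4 _≈_
infixl 6 _⊕_
infixl 7 _⊗_

_⊕_ : Poly → Poly → Poly
p ⊕ q = p ++ q

mulTerm : Term → Term → Term
mulTerm (c , a , b , d) (c' , a' , b' , d') =
  (c *ℤ c' , a +ℕ a' , b +ℕ b' , d +ℕ d')

_⊗_ : Poly → Poly → Poly
p ⊗ q = concatMap (λ t → map (mulTerm t) q) p

mono : ℕ → ℕ → ℕ → Poly
mono i j k = (+ 1 , i , j , k) ∷ []

squareVars : Poly → Poly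
squareVars = map (λ { (c , a , b , d) → (c , 2 *ℕ a , 2 *ℕ b , 2 *ℕ d) })

-- Rational functions in x,y,z as (numerator , denominator) pairs,
-- i.e. elements of the fraction field ℚ(x,y,z) (unreduced).

RatFun : Set
RatFun = Poly × Poly

addR : RatFun → RatFun → RatFun
addR (a , b) (c , d) = (a ⊗ d ⊕ c ⊗ b , b ⊗ d)

sqR : RatFun → RatFun
sqR (a , b) = (a ⊗ a , b ⊗ b)

divR : RatFun → RatFun → RatFun
divR (a , b) (c , d) = (a ⊗ d , b ⊗ c)

X Y Z : Poly
X = mono 1 0 0
Y = mono 0 1 0
Z = mono 0 0 1

one : Poly
one = mono 0 0 0

-- A node records a Farey triple  p/q , μ = (p+r)/(q+s) , r/s
-- (with qr - ps = 1) together with  M_{p/q}, M_μ, M_{r/s}.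

Frac : Set
Frac = ℕ × ℕ

_+F_ : Frac → Frac → Frac
(p , q) +F (r , s) = (p +ℕ r , q +ℕ s)

record Node : Set where
  constructor node
  field
    fl fm fr : Frac
    Ml Mm Mr : RatFun

root : Node
root = node (0 , 1) (1 , 1) (1 , 0)
            (X , one) (X ⊗ X ⊕ Y ⊗ Y , Z) (Y , one)

data Dir : Set where
  L R : Dir

step : Dir → Node → Node
step L (node l m r Ml Mm Mr) =
  node l (l +F m) m Ml (divR (addR (sqR Ml) (sqR Mm)) Mr) Mm
step R (node l m r Ml Mm Mr) =
  node m (m +F r) r Mm (divR (addR (sqR Mm) (sqR Mr)) Ml) Mr

-- node reached from the root along a path (first direction first)
walk : List Dir → Node
walk ds = foldr step root (reverse′ ds)
  where
  reverse′ : List Dir → List Dir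
  reverse′ = foldr (λ d acc → acc ++ (d ∷ [])) []

fracAt : List Dir → Frac
fracAt ds = Node.fm (walk ds)

markovAt : List Dir → RatFun
markovAt ds = Node.Mm (walk ds)

-- P is the numerator of M_{a/b} (a,b ≥ 1) :
--   M_{a/b} = P(x²,y²,z²) / (x^{a-1} y^{b-1} z^{a+b-1}),
-- i.e. with M_{a/b} = N/D:  P(x²,y²,z²) · D = N · x^{a-1} y^{b-1} z^{a+b-1}.

IsNumerator : ℕ → ℕ → RatFun → Poly → Set
IsNumerator a b (N , D) P =
  squareVars P ⊗ D ≈ N ⊗ mono (a ∸ 1) (b ∸ 1) (a +ℕ b ∸ 1)

-- Along the path L R^(n-1) to n/(n+1) the right neighbour is always 1/1, with M_{1/1} = (x²+y²)/z,
-- so each new Markov polynomial is (M_{k+1}² + M_{1/1}²)/M_k.  The sequence defined by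
-- P_{k+2} = ((u+v)² + w(u+v)) P_{k+1} - w²uv P_k has the Cassini invariant
-- P_{k+2} P_k - P_{k+1}² = (w²uv)^k (u+v)² vw, and at (u,v,w) = (x²,y²,z²) this is exactly what makes
-- x P_k / (xyz²)^k satisfy that exchange relation; so P_n is the numerator of M_{n/(n+1)}.  Read in w,
-- the recurrence shows that the coefficient of w^(n-1) in P_n is (u+v)² Σ_{s=1}^{n} s u^(s-1) v^(n-s),
-- whose coefficient of u^m v^(n+1-m) is (m-1) + 2m + (m+1) = 4m.
--
-- Identities between rational functions are checked on values at positive integers, where all
-- numerators and denominators are positive.  Coefficients are recovered from values at squares, one
-- variable at a time: the value at a point exceeding the sum of the absolute coefficients determines them.

module Submission where

open import Defs

module CoefficientLists where

  open import Data.Nat as ℕ using (ℕ; zero; suc; _≤_; _<_; _≡ᵇ_; s≤s)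
  import Data.Nat.Properties as ℕ
  open import Data.Integer using (ℤ; +_; -_; _+_; _-_; _*_; _^_; ∣_∣; 0ℤ; 1ℤ; -1ℤ; ≢-nonZero)
  import Data.Integer.Properties as ℤ
  import Algebra.Properties.AbelianGroup ℤ.+-0-abelianGroup as +-Group
  open import Data.Integer.Tactic.RingSolver using (solve-∀; solve)
  open import Data.Bool using (if_then_else_)
  open import Data.List using (List; []; _∷_; map; applyUpTo)
  open import Function using (_∘_)
  open import Relation.Nullary using (yes; no; contradiction)
  open import Relation.Binary.PropositionalEquality
  open ≡-Reasoning

  infixl 5 _⊞_
  infixr 6 _·_

  eval : List ℤ → ℤ → ℤ
  eval []       t = 0ℤ
  eval (c ∷ cs) t = c + t * eval cs t

  _‼_ : List ℤ → ℕ → ℤ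
  []       ‼ k     = 0ℤ
  (c ∷ cs) ‼ zero  = c
  (c ∷ cs) ‼ suc k = cs ‼ k

  _⊞_ : List ℤ → List ℤ → List ℤ
  []      ⊞ q       = q
  (a ∷ p) ⊞ []      = a ∷ p
  (a ∷ p) ⊞ (b ∷ q) = a + b ∷ (p ⊞ q)

  _·_ : ℤ → List ℤ → List ℤ
  c · p = map (c *_) p

  eval-⊞ : ∀ p q t → eval (p ⊞ q) t ≡ eval p t + eval q t
  eval-⊞ []      q       t = sym (ℤ.+-identityˡ _)
  eval-⊞ (a ∷ p) []      t = sym (ℤ.+-identityʳ _)
  eval-⊞ (a ∷ p) (b ∷ q) t = begin
    a + b + t * eval (p ⊞ q) t         ≡⟨ cong (λ e → a + b + t * e) (eval-⊞ p q t) ⟩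
    a + b + t * (eval p t + eval q t)  ≡⟨ regroup a b t (eval p t) (eval q t) ⟩
    a + t * eval p t + (b + t * eval q t) ∎
    where
    regroup : ∀ a b t P Q → a + b + t * (P + Q) ≡ a + t * P + (b + t * Q)
    regroup = solve-∀

  eval-· : ∀ c p t → eval (c · p) t ≡ c * eval p t
  eval-· c []      t = sym (ℤ.*-zeroʳ c)
  eval-· c (a ∷ p) t = begin
    c * a + t * eval (c · p) t   ≡⟨ cong (λ e → c * a + t * e) (eval-· c p t) ⟩
    c * a + t * (c * eval p t)   ≡⟨ regroup c a t (eval p t) ⟩
    c * (a + t * eval p t)       ∎
    where
    regroup : ∀ c a t P → c * a + t * (c * P) ≡ c * (a + t * P)
    regroup = solve-∀

  ‼-⊞ : ∀ p q k → (p ⊞ q) ‼ k ≡ p ‼ k + q ‼ k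
  ‼-⊞ []      q       k       = sym (ℤ.+-identityˡ _)
  ‼-⊞ (a ∷ p) []      k       = sym (ℤ.+-identityʳ _)
  ‼-⊞ (a ∷ p) (b ∷ q) zero    = refl
  ‼-⊞ (a ∷ p) (b ∷ q) (suc k) = ‼-⊞ p q k

  ‼-· : ∀ c p k → (c · p) ‼ k ≡ c * p ‼ k
  ‼-· c []      k       = sym (ℤ.*-zeroʳ c)
  ‼-· c (a ∷ p) zero    = refl
  ‼-· c (a ∷ p) (suc k) = ‼-· c p k

  norm : List ℤ → ℕ
  norm []       = 0
  norm (c ∷ cs) = ∣ c ∣ ℕ.+ norm cs

  root-bounds-constant : ∀ c e W → c + + W * e ≡ 0ℤ → e ≢ 0ℤ → W ≤ ∣ c ∣
  root-bounds-constant c e W vanishes e≢0 =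
    subst (W ≤_) W∣e∣≡∣c∣ (ℕ.m≤m*n W ∣ e ∣ {{≢-nonZero e≢0}})
    where
    W∣e∣≡∣c∣ : W ℕ.* ∣ e ∣ ≡ ∣ c ∣
    W∣e∣≡∣c∣ = begin
      W ℕ.* ∣ e ∣      ≡⟨ ℤ.abs-* (+ W) e ⟨
      ∣ + W * e ∣      ≡⟨ ℤ.∣-i∣≡∣i∣ (+ W * e) ⟨
      ∣ - (+ W * e) ∣  ≡⟨ cong ∣_∣ (+-Group.inverseˡ-unique c (+ W * e) vanishes) ⟨
      ∣ c ∣            ∎

  eval≡0⇒‼≡0 : ∀ p W → norm p < W → eval p (+ W) ≡ 0ℤ → ∀ k → p ‼ k ≡ 0ℤ
  eval≡0⇒‼≡0 []       W _     _        k = refl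
  eval≡0⇒‼≡0 (c ∷ cs) W small vanishes k with eval cs (+ W) ℤ.≟ 0ℤ
  ... | no tail≢0 =
    contradiction (ℕ.≤-trans (root-bounds-constant c _ W vanishes tail≢0) (ℕ.m≤m+n ∣ c ∣ (norm cs))) (ℕ.<⇒≱ small)
  eval≡0⇒‼≡0 (c ∷ cs) W small vanishes zero    | yes tail≡0 = begin
    c                        ≡⟨ ℤ.+-identityʳ c ⟨
    c + 0ℤ                   ≡⟨ cong (λ e → c + e) (ℤ.*-zeroʳ (+ W)) ⟨
    c + + W * 0ℤ             ≡⟨ cong (λ e → c + + W * e) tail≡0 ⟨
    c + + W * eval cs (+ W)  ≡⟨ vanishes ⟩
    0ℤ                       ∎
  eval≡0⇒‼≡0 (c ∷ cs) W small vanishes (suc k) | yes tail≡0 =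
    eval≡0⇒‼≡0 cs W (ℕ.≤-<-trans (ℕ.m≤n+m (norm cs) ∣ c ∣) small) tail≡0 k

  -- Values are taken at squares because numerators are evaluated at (x², y², z²).
  sq : ℕ → ℤ
  sq t = + suc t * + suc t

  agree-on-squares⇒‼-agree : ∀ p q → (∀ t → eval p (sq t) ≡ eval q (sq t)) → ∀ k → p ‼ k ≡ q ‼ k
  agree-on-squares⇒‼-agree p q agree k = ℤ.i-j≡0⇒i≡j (p ‼ k) (q ‼ k) (begin
    p ‼ k - q ‼ k          ≡⟨ cong (λ e → p ‼ k + e) (ℤ.-1*i≡-i (q ‼ k)) ⟨
    p ‼ k + -1ℤ * q ‼ k    ≡⟨ cong (λ e → p ‼ k + e) (‼-· -1ℤ q k) ⟨
    p ‼ k + (-1ℤ · q) ‼ k  ≡⟨ ‼-⊞ p (-1ℤ · q) k ⟨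
    d ‼ k                  ≡⟨ eval≡0⇒‼≡0 d W N<W d[W]≡0 k ⟩
    0ℤ                     ∎)
    where
    d = p ⊞ -1ℤ · q
    N = norm d
    W = suc N ℕ.* suc N
    N<W : N < W
    N<W = ℕ.m≤m*n (suc N) (suc N)
    d[W]≡0 : eval d (+ W) ≡ 0ℤ
    d[W]≡0 = begin
      eval d (+ W)                        ≡⟨ eval-⊞ p (-1ℤ · q) (+ W) ⟩
      eval p (+ W) + eval (-1ℤ · q) (+ W) ≡⟨ cong (λ e → eval p (+ W) + e) (eval-· -1ℤ q (+ W)) ⟩
      eval p (+ W) + -1ℤ * eval q (+ W)   ≡⟨ cong (λ e → e + -1ℤ * eval q (+ W)) (agree N) ⟩
      eval q (+ W) + -1ℤ * eval q (+ W)   ≡⟨ cancel (eval q (+ W)) ⟩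
      0ℤ                                  ∎
      where
      cancel : ∀ e → e + -1ℤ * e ≡ 0ℤ
      cancel = solve-∀

  series : ℕ → (ℕ → ℤ) → ℤ → ℤ
  series d f t = eval (applyUpTo f d) t

  ‼-applyUpTo : ∀ f {d k} → k < d → applyUpTo f d ‼ k ≡ f k
  ‼-applyUpTo f {suc d} {zero}  _         = refl
  ‼-applyUpTo f {suc d} {suc k} (s≤s k<d) = ‼-applyUpTo (f ∘ suc) k<d

  applyUpTo-cong : ∀ {f g : ℕ → ℤ} d → (∀ k → f k ≡ g k) → applyUpTo f d ≡ applyUpTo g d
  applyUpTo-cong zero    f≗g = refl
  applyUpTo-cong (suc d) f≗g = cong₂ _∷_ (f≗g 0) (applyUpTo-cong d (f≗g ∘ suc))

  applyUpTo-+ : ∀ f g d → applyUpTo (λ k → f k + g k) d ≡ applyUpTo f d ⊞ applyUpTo g d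
  applyUpTo-+ f g zero    = refl
  applyUpTo-+ f g (suc d) = cong (f 0 + g 0 ∷_) (applyUpTo-+ (f ∘ suc) (g ∘ suc) d)

  series-cong : ∀ {f g : ℕ → ℤ} d → (∀ k → f k ≡ g k) → ∀ t → series d f t ≡ series d g t
  series-cong d f≗g t = cong (λ p → eval p t) (applyUpTo-cong d f≗g)

  series-+ : ∀ f g d t → series d (λ k → f k + g k) t ≡ series d f t + series d g t
  series-+ f g d t = trans (cong (λ p → eval p t) (applyUpTo-+ f g d)) (eval-⊞ (applyUpTo f d) (applyUpTo g d) t)

  series-0 : ∀ d t → series d (λ _ → 0ℤ) t ≡ 0ℤ
  series-0 zero    t = refl
  series-0 (suc d) t = begin
    0ℤ + t * series d (λ _ → 0ℤ) t  ≡⟨ cong (λ e → 0ℤ + t * e) (series-0 d t) ⟩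
    0ℤ + t * 0ℤ                     ≡⟨ cong (λ e → 0ℤ + e) (ℤ.*-zeroʳ t) ⟩
    0ℤ                              ∎

  series-δ : ∀ {a d} c t → a < d → series d (λ k → if a ≡ᵇ k then c else 0ℤ) t ≡ c * t ^ a
  series-δ {zero}  {suc d} c t _ = begin
    c + t * series d (λ _ → 0ℤ) t  ≡⟨ cong (λ e → c + t * e) (series-0 d t) ⟩
    c + t * 0ℤ                     ≡⟨ solve (c ∷ t ∷ []) ⟩
    c * 1ℤ                         ∎
  series-δ {suc a} {suc d} c t (s≤s a<d) = begin
    0ℤ + t * series d (λ k → if a ≡ᵇ k then c else 0ℤ) t  ≡⟨ cong (λ e → 0ℤ + t * e) (series-δ c t a<d) ⟩
    0ℤ + t * (c * t ^ a)                                  ≡⟨ shuffle c t (t ^ a) ⟩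
    c * (t * t ^ a)                                       ∎
    where
    shuffle : ∀ c t P → 0ℤ + t * (c * P) ≡ c * (t * P)
    shuffle = solve-∀

  coefficient-from-squares : ∀ d f p {k} → k < d → (∀ t → series d f (sq t) ≡ eval p (sq t)) → f k ≡ p ‼ k
  coefficient-from-squares d f p {k} k<d agree =
    trans (sym (‼-applyUpTo f k<d)) (agree-on-squares⇒‼-agree (applyUpTo f d) p agree k)

  monomial : ℕ → ℤ → List ℤ
  monomial zero    c = c ∷ []
  monomial (suc k) c = 0ℤ ∷ monomial k c

  eval-monomial : ∀ k c t → eval (monomial k c) t ≡ c * t ^ k
  eval-monomial zero    c t = begin
    c + t * 0ℤ  ≡⟨ solve (c ∷ t ∷ []) ⟩
    c * 1ℤ      ∎
  eval-monomial (suc k) c t = begin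
    0ℤ + t * eval (monomial k c) t  ≡⟨ cong (λ e → 0ℤ + t * e) (eval-monomial k c t) ⟩
    0ℤ + t * (c * t ^ k)            ≡⟨ shuffle c t (t ^ k) ⟩
    c * (t * t ^ k)                 ∎
    where
    shuffle : ∀ c t P → 0ℤ + t * (c * P) ≡ c * (t * P)
    shuffle = solve-∀

  ‼-monomial : ∀ k c → monomial k c ‼ k ≡ c
  ‼-monomial zero    c = refl
  ‼-monomial (suc k) c = ‼-monomial k c

  infixr 6 _+X·_

  _+X·_ : ℤ → List ℤ → List ℤ
  c +X· p = c · p ⊞ (0ℤ ∷ p)

  eval-+X· : ∀ c p t → eval (c +X· p) t ≡ (c + t) * eval p t
  eval-+X· c p t = begin
    eval (c · p ⊞ (0ℤ ∷ p)) t               ≡⟨ eval-⊞ (c · p) (0ℤ ∷ p) t ⟩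
    eval (c · p) t + (0ℤ + t * eval p t)    ≡⟨ cong (λ e → e + (0ℤ + t * eval p t)) (eval-· c p t) ⟩
    c * eval p t + (0ℤ + t * eval p t)      ≡⟨ factor c t (eval p t) ⟩
    (c + t) * eval p t                      ∎
    where
    factor : ∀ c t P → c * P + (0ℤ + t * P) ≡ (c + t) * P
    factor = solve-∀

  ‼-+X· : ∀ c p k → (c +X· p) ‼ suc k ≡ c * p ‼ suc k + p ‼ k
  ‼-+X· c p k = trans (‼-⊞ (c · p) (0ℤ ∷ p) (suc k)) (cong (λ e → e + p ‼ k) (‼-· c p (suc k)))

  eval-+X·-+X· : ∀ c p t → eval (c +X· c +X· p) t ≡ (c + t) * (c + t) * eval p t
  eval-+X·-+X· c p t = begin
    eval (c +X· c +X· p) t          ≡⟨ eval-+X· c (c +X· p) t ⟩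
    (c + t) * eval (c +X· p) t      ≡⟨ cong ((c + t) *_) (eval-+X· c p t) ⟩
    (c + t) * ((c + t) * eval p t)  ≡⟨ ℤ.*-assoc (c + t) (c + t) (eval p t) ⟨
    (c + t) * (c + t) * eval p t    ∎

module Evaluation where

  open CoefficientLists
  open import Data.Nat as ℕ using (ℕ; suc; _≤_; _<_; _≡ᵇ_)
  import Data.Nat.Properties as ℕ
  open import Data.Integer using (ℤ; _+_; _*_; _^_; 0ℤ; 1ℤ)
  import Data.Integer.Properties as ℤ
  open import Data.Integer.Tactic.RingSolver using (solve-∀)
  open import Data.Bool using (true; false; if_then_else_; _∧_)
  open import Data.List using ([]; _∷_; map)
  open import Data.Product using (_,_)
  open import Relation.Binary.PropositionalEquality
  open ≡-Reasoning

  ⟦_⟧ₜ : Term → ℤ → ℤ → ℤ → ℤ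
  ⟦ c , i , j , k ⟧ₜ x y z = c * x ^ i * y ^ j * z ^ k

  ⟦_⟧ : Poly → ℤ → ℤ → ℤ → ℤ
  ⟦ []    ⟧ x y z = 0ℤ
  ⟦ t ∷ p ⟧ x y z = ⟦ t ⟧ₜ x y z + ⟦ p ⟧ x y z

  module _ (x y z : ℤ) where

    ⟦⟧-⊕ : ∀ p q → ⟦ p ⊕ q ⟧ x y z ≡ ⟦ p ⟧ x y z + ⟦ q ⟧ x y z
    ⟦⟧-⊕ []      q = sym (ℤ.+-identityˡ (⟦ q ⟧ x y z))
    ⟦⟧-⊕ (t ∷ p) q = trans (cong (λ e → ⟦ t ⟧ₜ x y z + e) (⟦⟧-⊕ p q))
                           (sym (ℤ.+-assoc (⟦ t ⟧ₜ x y z) (⟦ p ⟧ x y z) (⟦ q ⟧ x y z)))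

    ⟦⟧ₜ-mulTerm : ∀ s t → ⟦ mulTerm s t ⟧ₜ x y z ≡ ⟦ s ⟧ₜ x y z * ⟦ t ⟧ₜ x y z
    ⟦⟧ₜ-mulTerm (c , i , j , k) (c′ , i′ , j′ , k′) = begin
      c * c′ * x ^ (i ℕ.+ i′) * y ^ (j ℕ.+ j′) * z ^ (k ℕ.+ k′)
        ≡⟨ cong₂ (λ X Y → c * c′ * X * Y * z ^ (k ℕ.+ k′)) (ℤ.^-distribˡ-+-* x i i′) (ℤ.^-distribˡ-+-* y j j′) ⟩
      c * c′ * (x ^ i * x ^ i′) * (y ^ j * y ^ j′) * z ^ (k ℕ.+ k′)
        ≡⟨ cong (c * c′ * (x ^ i * x ^ i′) * (y ^ j * y ^ j′) *_) (ℤ.^-distribˡ-+-* z k k′) ⟩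
      c * c′ * (x ^ i * x ^ i′) * (y ^ j * y ^ j′) * (z ^ k * z ^ k′)
        ≡⟨ regroup c c′ (x ^ i) (x ^ i′) (y ^ j) (y ^ j′) (z ^ k) (z ^ k′) ⟩
      c * x ^ i * y ^ j * z ^ k * (c′ * x ^ i′ * y ^ j′ * z ^ k′) ∎
      where
      regroup : ∀ c c′ a a′ b b′ e e′ →
        c * c′ * (a * a′) * (b * b′) * (e * e′) ≡ c * a * b * e * (c′ * a′ * b′ * e′)
      regroup = solve-∀

    ⟦⟧-map-mulTerm : ∀ s q → ⟦ map (mulTerm s) q ⟧ x y z ≡ ⟦ s ⟧ₜ x y z * ⟦ q ⟧ x y z
    ⟦⟧-map-mulTerm s []      = sym (ℤ.*-zeroʳ (⟦ s ⟧ₜ x y z))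
    ⟦⟧-map-mulTerm s (t ∷ q) = begin
      ⟦ mulTerm s t ⟧ₜ x y z + ⟦ map (mulTerm s) q ⟧ x y z
        ≡⟨ cong₂ _+_ (⟦⟧ₜ-mulTerm s t) (⟦⟧-map-mulTerm s q) ⟩
      ⟦ s ⟧ₜ x y z * ⟦ t ⟧ₜ x y z + ⟦ s ⟧ₜ x y z * ⟦ q ⟧ x y z
        ≡⟨ ℤ.*-distribˡ-+ (⟦ s ⟧ₜ x y z) (⟦ t ⟧ₜ x y z) (⟦ q ⟧ x y z) ⟨
      ⟦ s ⟧ₜ x y z * (⟦ t ⟧ₜ x y z + ⟦ q ⟧ x y z) ∎

    ⟦⟧-⊗ : ∀ p q → ⟦ p ⊗ q ⟧ x y z ≡ ⟦ p ⟧ x y z * ⟦ q ⟧ x y z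
    ⟦⟧-⊗ []      q = refl
    ⟦⟧-⊗ (t ∷ p) q = begin
      ⟦ map (mulTerm t) q ⊕ p ⊗ q ⟧ x y z
        ≡⟨ ⟦⟧-⊕ (map (mulTerm t) q) (p ⊗ q) ⟩
      ⟦ map (mulTerm t) q ⟧ x y z + ⟦ p ⊗ q ⟧ x y z
        ≡⟨ cong₂ _+_ (⟦⟧-map-mulTerm t q) (⟦⟧-⊗ p q) ⟩
      ⟦ t ⟧ₜ x y z * ⟦ q ⟧ x y z + ⟦ p ⟧ x y z * ⟦ q ⟧ x y z
        ≡⟨ ℤ.*-distribʳ-+ (⟦ q ⟧ x y z) (⟦ t ⟧ₜ x y z) (⟦ p ⟧ x y z) ⟨
      (⟦ t ⟧ₜ x y z + ⟦ p ⟧ x y z) * ⟦ q ⟧ x y z ∎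

    ⟦⟧-mono : ∀ i j k → ⟦ mono i j k ⟧ x y z ≡ x ^ i * y ^ j * z ^ k
    ⟦⟧-mono i j k = unit (x ^ i) (y ^ j) (z ^ k)
      where
      unit : ∀ a b e → 1ℤ * a * b * e + 0ℤ ≡ a * b * e
      unit = solve-∀

    ^-double : ∀ w n → w ^ (2 ℕ.* n) ≡ (w * w) ^ n
    ^-double w n = trans (sym (ℤ.^-*-assoc w 2 n)) (cong (_^ n) (cong (w *_) (ℤ.*-identityʳ w)))

    ⟦⟧-squareVars : ∀ p → ⟦ squareVars p ⟧ x y z ≡ ⟦ p ⟧ (x * x) (y * y) (z * z)
    ⟦⟧-squareVars []                  = refl
    ⟦⟧-squareVars ((c , i , j , k) ∷ p)
      rewrite ^-double x i | ^-double y j | ^-double z k | ⟦⟧-squareVars p = refl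

  series³ : ℕ → (ℕ → ℕ → ℕ → ℤ) → ℤ → ℤ → ℤ → ℤ
  series³ d C u v w = series d (λ k → series d (λ j → series d (λ i → C i j k) u) v) w

  series³-cong : ∀ {C C′} d → (∀ i j k → C i j k ≡ C′ i j k) → ∀ u v w → series³ d C u v w ≡ series³ d C′ u v w
  series³-cong d C≗C′ u v w =
    series-cong d (λ k → series-cong d (λ j → series-cong d (λ i → C≗C′ i j k) u) v) w

  series³-+ : ∀ C C′ d u v w →
    series³ d (λ i j k → C i j k + C′ i j k) u v w ≡ series³ d C u v w + series³ d C′ u v w
  series³-+ C C′ d u v w = trans
    (series-cong d (λ k → trans (series-cong d (λ j → series-+ (λ i → C i j k) (λ i → C′ i j k) d u) v)
                                (series-+ _ _ d v)) w)
    (series-+ _ _ d w)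

  series³-0 : ∀ d u v w → series³ d (λ _ _ _ → 0ℤ) u v w ≡ 0ℤ
  series³-0 d u v w = trans
    (series-cong d (λ k → trans (series-cong d (λ j → series-0 d u) v) (series-0 d v)) w)
    (series-0 d w)

  if-∧ : ∀ A B (c : ℤ) → (if A ∧ B then c else 0ℤ) ≡ (if A then (if B then c else 0ℤ) else 0ℤ)
  if-∧ true  B c = refl
  if-∧ false B c = refl

  if-* : ∀ B c s → (if B then c else 0ℤ) * s ≡ (if B then c * s else 0ℤ)
  if-* true  c s = refl
  if-* false c s = ℤ.*-zeroˡ s

  series-δ∧ : ∀ {a d} B c t → a < d →
    series d (λ i → if (a ≡ᵇ i) ∧ B then c else 0ℤ) t ≡ (if B then c * t ^ a else 0ℤ)
  series-δ∧ {a} {d} B c t a<d = begin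
    series d (λ i → if (a ≡ᵇ i) ∧ B then c else 0ℤ) t                  ≡⟨ series-cong d (λ i → if-∧ (a ≡ᵇ i) B c) t ⟩
    series d (λ i → if a ≡ᵇ i then (if B then c else 0ℤ) else 0ℤ) t  ≡⟨ series-δ (if B then c else 0ℤ) t a<d ⟩
    (if B then c else 0ℤ) * t ^ a                                      ≡⟨ if-* B c (t ^ a) ⟩
    (if B then c * t ^ a else 0ℤ)                                      ∎

  series³-term : ∀ {d} c a b e u v w → a < d → b < d → e < d →
    series³ d (λ i j k → if (a ≡ᵇ i) ∧ (b ≡ᵇ j) ∧ (e ≡ᵇ k) then c else 0ℤ) u v w ≡ ⟦ c , a , b , e ⟧ₜ u v w
  series³-term {d} c a b e u v w a<d b<d e<d = trans
    (series-cong d (λ k → trans (series-cong d (λ j → series-δ∧ _ c u a<d) v) (series-δ∧ _ (c * u ^ a) v b<d)) w)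
    (series-δ (c * u ^ a * v ^ b) w e<d)

  coeff-∷ : ∀ c a b e p i j k →
    coeff ((c , a , b , e) ∷ p) i j k ≡ (if (a ≡ᵇ i) ∧ (b ≡ᵇ j) ∧ (e ≡ᵇ k) then c else 0ℤ) + coeff p i j k
  coeff-∷ c a b e p i j k with (a ≡ᵇ i) ∧ (b ≡ᵇ j) ∧ (e ≡ᵇ k)
  ... | true  = refl
  ... | false = sym (ℤ.+-identityˡ (coeff p i j k))

  bound : Poly → ℕ
  bound []                  = 0
  bound ((_ , i , j , k) ∷ p) = suc (i ℕ.⊔ j ℕ.⊔ k) ℕ.⊔ bound p

  expansion : ∀ p {d} → bound p ≤ d → ∀ u v w → ⟦ p ⟧ u v w ≡ series³ d (coeff p) u v w
  expansion []                    {d} _ u v w = sym (series³-0 d u v w)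
  expansion ((c , a , b , e) ∷ p) {d} p≤d u v w = begin
    ⟦ c , a , b , e ⟧ₜ u v w + ⟦ p ⟧ u v w
      ≡⟨ cong₂ _+_ (sym (series³-term c a b e u v w a<d b<d e<d)) (expansion p p≤d′ u v w) ⟩
    series³ d δ u v w + series³ d (coeff p) u v w
      ≡⟨ series³-+ δ (coeff p) d u v w ⟨
    series³ d (λ i j k → δ i j k + coeff p i j k) u v w
      ≡⟨ series³-cong d (λ i j k → coeff-∷ c a b e p i j k) u v w ⟨
    series³ d (coeff ((c , a , b , e) ∷ p)) u v w ∎
    where
    δ : ℕ → ℕ → ℕ → ℤ
    δ i j k = if (a ≡ᵇ i) ∧ (b ≡ᵇ j) ∧ (e ≡ᵇ k) then c else 0ℤ
    p≤d′ : bound p ≤ d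
    p≤d′ = ℕ.m⊔n≤o⇒n≤o (suc (a ℕ.⊔ b ℕ.⊔ e)) (bound p) p≤d
    max<d : a ℕ.⊔ b ℕ.⊔ e < d
    max<d = ℕ.m⊔n≤o⇒m≤o (suc (a ℕ.⊔ b ℕ.⊔ e)) (bound p) p≤d
    a<d : a < d
    a<d = ℕ.≤-<-trans (ℕ.≤-trans (ℕ.m≤m⊔n a b) (ℕ.m≤m⊔n (a ℕ.⊔ b) e)) max<d
    b<d : b < d
    b<d = ℕ.≤-<-trans (ℕ.≤-trans (ℕ.m≤n⊔m a b) (ℕ.m≤m⊔n (a ℕ.⊔ b) e)) max<d
    e<d : e < d
    e<d = ℕ.≤-<-trans (ℕ.m≤n⊔m (a ℕ.⊔ b) e) max<d

  ≈⇒⟦⟧≡ : ∀ {p q} → p ≈ q → ∀ u v w → ⟦ p ⟧ u v w ≡ ⟦ q ⟧ u v w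
  ≈⇒⟦⟧≡ {p} {q} p≈q u v w = begin
    ⟦ p ⟧ u v w               ≡⟨ expansion p (ℕ.m≤m⊔n (bound p) (bound q)) u v w ⟩
    series³ d (coeff p) u v w ≡⟨ series³-cong d p≈q u v w ⟩
    series³ d (coeff q) u v w ≡⟨ expansion q (ℕ.m≤n⊔m (bound p) (bound q)) u v w ⟨
    ⟦ q ⟧ u v w               ∎
    where
    d = bound p ℕ.⊔ bound q

module Numerators where

  open CoefficientLists
  open import Data.Nat as ℕ using (ℕ; zero; suc; _<_; _∸_; s≤s)
  import Data.Nat.Properties as ℕ
  open import Data.Integer using (ℤ; +_; -_; _+_; _-_; _*_; _^_; 0ℤ; 1ℤ)
  import Data.Integer.Properties as ℤ
  open import Data.Integer.Tactic.RingSolver using (solve-∀; solve)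
  open import Data.List using (List; []; _∷_)
  open import Relation.Binary.PropositionalEquality
  open ≡-Reasoning

  cassini : ∀ (a : ℕ → ℤ) T S → (∀ n → a (suc (suc n)) ≡ T * a (suc n) - S * a n) →
    ∀ n → a (suc (suc n)) * a n - a (suc n) * a (suc n) ≡ S ^ n * (a 2 * a 0 - a 1 * a 1)
  cassini a T S rec zero    = sym (ℤ.*-identityˡ _)
  cassini a T S rec (suc n) = begin
    a₃ * a₁ - a₂ * a₂                          ≡⟨ cong₂ (λ e f → e * a₁ - a₂ * f) (rec (suc n)) (rec n) ⟩
    (T * a₂ - S * a₁) * a₁ - a₂ * (T * a₁ - S * a₀) ≡⟨ invariant-step T S a₀ a₁ a₂ ⟩
    S * (a₂ * a₀ - a₁ * a₁)                     ≡⟨ cong (S *_) (cassini a T S rec n) ⟩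
    S * (S ^ n * (a 2 * a 0 - a 1 * a 1))       ≡⟨ ℤ.*-assoc S (S ^ n) _ ⟨
    S * S ^ n * (a 2 * a 0 - a 1 * a 1)         ∎
    where
    a₀ = a n
    a₁ = a (suc n)
    a₂ = a (suc (suc n))
    a₃ = a (suc (suc (suc n)))
    invariant-step : ∀ T S a₀ a₁ a₂ →
      (T * a₂ - S * a₁) * a₁ - a₂ * (T * a₁ - S * a₀) ≡ S * (a₂ * a₀ - a₁ * a₁)
    invariant-step = solve-∀

  combine : ℤ → ℤ → ℤ → List ℤ → List ℤ → List ℤ
  combine c₀ c₁ c₂ p q = c₀ · p ⊞ (0ℤ ∷ c₁ · p) ⊞ (0ℤ ∷ 0ℤ ∷ c₂ · q)

  eval-combine : ∀ c₀ c₁ c₂ p q t →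
    eval (combine c₀ c₁ c₂ p q) t ≡ (c₀ + t * c₁) * eval p t + t * t * c₂ * eval q t
  eval-combine c₀ c₁ c₂ p q t = begin
    eval (c₀ · p ⊞ (0ℤ ∷ c₁ · p) ⊞ (0ℤ ∷ 0ℤ ∷ c₂ · q)) t
      ≡⟨ eval-⊞ (c₀ · p ⊞ (0ℤ ∷ c₁ · p)) (0ℤ ∷ 0ℤ ∷ c₂ · q) t ⟩
    eval (c₀ · p ⊞ (0ℤ ∷ c₁ · p)) t + (0ℤ + t * (0ℤ + t * eval (c₂ · q) t))
      ≡⟨ cong₂ (λ e f → e + (0ℤ + t * (0ℤ + t * f))) (eval-⊞ (c₀ · p) (0ℤ ∷ c₁ · p) t) (eval-· c₂ q t) ⟩
    eval (c₀ · p) t + (0ℤ + t * eval (c₁ · p) t) + (0ℤ + t * (0ℤ + t * (c₂ * eval q t)))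
      ≡⟨ cong₂ (λ e f → e + (0ℤ + t * f) + (0ℤ + t * (0ℤ + t * (c₂ * eval q t))))
               (eval-· c₀ p t) (eval-· c₁ p t) ⟩
    c₀ * eval p t + (0ℤ + t * (c₁ * eval p t)) + (0ℤ + t * (0ℤ + t * (c₂ * eval q t)))
      ≡⟨ regroup c₀ c₁ c₂ t (eval p t) (eval q t) ⟩
    (c₀ + t * c₁) * eval p t + t * t * c₂ * eval q t ∎
    where
    regroup : ∀ c₀ c₁ c₂ t P Q → c₀ * P + (0ℤ + t * (c₁ * P)) + (0ℤ + t * (0ℤ + t * (c₂ * Q)))
                                ≡ (c₀ + t * c₁) * P + t * t * c₂ * Q
    regroup = solve-∀

  ‼-combine : ∀ c₀ c₁ c₂ p q k →
    combine c₀ c₁ c₂ p q ‼ suc (suc k) ≡ c₀ * p ‼ suc (suc k) + c₁ * p ‼ suc k + c₂ * q ‼ k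
  ‼-combine c₀ c₁ c₂ p q k = begin
    (c₀ · p ⊞ (0ℤ ∷ c₁ · p) ⊞ (0ℤ ∷ 0ℤ ∷ c₂ · q)) ‼ suc (suc k)
      ≡⟨ ‼-⊞ (c₀ · p ⊞ (0ℤ ∷ c₁ · p)) (0ℤ ∷ 0ℤ ∷ c₂ · q) (suc (suc k)) ⟩
    (c₀ · p ⊞ (0ℤ ∷ c₁ · p)) ‼ suc (suc k) + (c₂ · q) ‼ k
      ≡⟨ cong₂ _+_ (‼-⊞ (c₀ · p) (0ℤ ∷ c₁ · p) (suc (suc k))) (‼-· c₂ q k) ⟩
    (c₀ · p) ‼ suc (suc k) + (c₁ · p) ‼ suc k + c₂ * q ‼ k
      ≡⟨ cong₂ (λ e f → e + f + c₂ * q ‼ k) (‼-· c₀ p (suc (suc k))) (‼-· c₁ p (suc k)) ⟩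
    c₀ * p ‼ suc (suc k) + c₁ * p ‼ suc k + c₂ * q ‼ k ∎

  module _ (u : ℤ) where

    Q : ℕ → List ℤ
    Q zero    = []
    Q (suc n) = + suc n * u ^ n ∷ Q n

    ‼-Q : ∀ t s {n} → t ℕ.+ s ≡ n → Q n ‼ t ≡ + s * u ^ (s ∸ 1)
    ‼-Q zero    zero    refl = refl
    ‼-Q zero    (suc s) refl = refl
    ‼-Q (suc t) s       refl = ‼-Q t s refl

    ‼-square-Q : ∀ r m → (u +X· u +X· Q (suc (suc (r ℕ.+ m)))) ‼ suc (suc r) ≡ + (4 ℕ.* suc m) * u ^ suc m
    ‼-square-Q r m = begin
      (u +X· u +X· q) ‼ suc (suc r)
        ≡⟨ ‼-+X· u (u +X· q) (suc r) ⟩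
      u * (u +X· q) ‼ suc (suc r) + (u +X· q) ‼ suc r
        ≡⟨ cong₂ (λ e f → u * e + f) (‼-+X· u q (suc r)) (‼-+X· u q r) ⟩
      u * (u * q ‼ suc (suc r) + q ‼ suc r) + (u * q ‼ suc r + q ‼ r)
        ≡⟨ cong₂ (λ e f → u * (u * e + f) + (u * f + q ‼ r))
                 (‼-Q (suc (suc r)) m refl) (‼-Q (suc r) (suc m) (ℕ.+-suc (suc r) m)) ⟩
      u * (u * (+ m * u ^ (m ∸ 1)) + + suc m * u ^ m) + (u * (+ suc m * u ^ m) + q ‼ r)
        ≡⟨ cong (λ e → u * (u * (+ m * u ^ (m ∸ 1)) + + suc m * u ^ m) + (u * (+ suc m * u ^ m) + e))
                (‼-Q r (suc (suc m)) (trans (ℕ.+-suc r (suc m)) (cong suc (ℕ.+-suc r m)))) ⟩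
      u * (u * (+ m * u ^ (m ∸ 1)) + + suc m * u ^ m) + (u * (+ suc m * u ^ m) + + suc (suc m) * u ^ suc m)
        ≡⟨ collect m ⟩
      + (4 ℕ.* suc m) * u ^ suc m ∎
      where
      q = Q (suc (suc (r ℕ.+ m)))
      collect : ∀ m → u * (u * (+ m * u ^ (m ∸ 1)) + + suc m * u ^ m) + (u * (+ suc m * u ^ m) + + suc (suc m) * u ^ suc m)
                      ≡ + (4 ℕ.* suc m) * u ^ suc m
      collect zero = begin
        u * (u * (+ 0 * 1ℤ) + + 1 * 1ℤ) + (u * (+ 1 * 1ℤ) + + 2 * (u * 1ℤ))  ≡⟨ solve (u ∷ []) ⟩
        + 4 * (u * 1ℤ)                                                      ∎
      collect (suc k) = trans (lemma u (+ k) (u ^ k)) (cong (_* (u * (u * u ^ k))) (sym (ℤ.pos-* 4 (suc (suc k)))))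
        where
        lemma : ∀ u N P →
          u * (u * ((1ℤ + N) * P) + (1ℤ + (1ℤ + N)) * (u * P))
            + (u * ((1ℤ + (1ℤ + N)) * (u * P)) + (1ℤ + (1ℤ + (1ℤ + N))) * (u * (u * P)))
                          ≡ + 4 * (1ℤ + (1ℤ + N)) * (u * (u * P))
        lemma = solve-∀

  module _ (u v : ℤ) where

    -- P_{n/(n+1)}(u, v, w) as a polynomial in w, with coefficients evaluated at u, v
    numW : ℕ → List ℤ
    numW zero          = 1ℤ ∷ []
    numW (suc zero)    = (u + v) * (u + v) ∷ u ∷ []
    numW (suc (suc n)) = combine ((u + v) * (u + v)) (u + v) (- (u * v)) (numW (suc n)) (numW n)

    ‼-numW-recurrence : ∀ n k {a b c} →
      numW (suc n) ‼ suc (suc k) ≡ a → numW (suc n) ‼ suc k ≡ b → numW n ‼ k ≡ c →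
      numW (suc (suc n)) ‼ suc (suc k) ≡ (u + v) * (u + v) * a + (u + v) * b + - (u * v) * c
    ‼-numW-recurrence n k refl refl refl =
      ‼-combine ((u + v) * (u + v)) (u + v) (- (u * v)) (numW (suc n)) (numW n) k

    ‼-numW-above : ∀ {n k} → n < k → numW n ‼ k ≡ 0ℤ
    ‼-numW-above {zero}        {suc k}       _                = refl
    ‼-numW-above {suc zero}    {suc zero}    (s≤s ())
    ‼-numW-above {suc zero}    {suc (suc k)} _                = refl
    ‼-numW-above {suc (suc n)} {suc (suc k)} (s≤s (s≤s n<k)) =
      trans (‼-numW-recurrence n k (‼-numW-above (s≤s (s≤s (ℕ.<⇒≤ n<k)))) (‼-numW-above (s≤s n<k)) (‼-numW-above n<k))
            (zeros (u + v) (u * v))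
      where
      zeros : ∀ s p → s * s * 0ℤ + s * 0ℤ + - p * 0ℤ ≡ 0ℤ
      zeros = solve-∀

    ‼-numW-top : ∀ n → numW n ‼ n ≡ u ^ n
    ‼-numW-top zero          = refl
    ‼-numW-top (suc zero)    = sym (ℤ.*-identityʳ u)
    ‼-numW-top (suc (suc n)) =
      trans (‼-numW-recurrence n n (‼-numW-above (ℕ.n<1+n (suc n))) (‼-numW-top (suc n)) (‼-numW-top n))
            (leading u v (u ^ n))
      where
      leading : ∀ u v P → (u + v) * (u + v) * 0ℤ + (u + v) * (u * P) + - (u * v) * P ≡ u * (u * P)
      leading = solve-∀

    ‼-numW-subtop : ∀ n → numW (suc n) ‼ n ≡ (u + v) * (u + v) * eval (Q u (suc n)) v
    ‼-numW-subtop zero = begin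
      (u + v) * (u + v)                                 ≡⟨ solve (u ∷ v ∷ []) ⟩
      (u + v) * (u + v) * (+ 1 * 1ℤ + v * 0ℤ)           ∎
    ‼-numW-subtop (suc zero) = begin
      (u + v) * (u + v) * u + (u + v) * ((u + v) * (u + v)) + 0ℤ             ≡⟨ solve (u ∷ v ∷ []) ⟩
      (u + v) * (u + v) * (+ 2 * (u * 1ℤ) + v * (+ 1 * 1ℤ + v * 0ℤ))          ∎
    ‼-numW-subtop (suc (suc r)) =
      trans (‼-numW-recurrence (suc r) r (‼-numW-top (suc (suc r))) (‼-numW-subtop (suc r)) (‼-numW-subtop r))
            (subleading u v (+ r) (u ^ r) (eval (Q u (suc r)) v))
      where
      subleading : ∀ u v N P q → (u + v) * (u + v) * (u * (u * P))
          + (u + v) * ((u + v) * (u + v) * ((1ℤ + (1ℤ + N)) * (u * P) + v * q))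
          + - (u * v) * ((u + v) * (u + v) * q)
        ≡ (u + v) * (u + v) * ((1ℤ + (1ℤ + (1ℤ + N))) * (u * (u * P)) + v * ((1ℤ + (1ℤ + N)) * (u * P) + v * q))
      subleading = solve-∀

  num : ℕ → ℤ → ℤ → ℤ → ℤ
  num n u v w = eval (numW u v n) w

  num-recurrence : ∀ n u v w →
    num (suc (suc n)) u v w ≡ ((u + v) * (u + v) + w * (u + v)) * num (suc n) u v w - w * w * (u * v) * num n u v w
  num-recurrence n u v w =
    trans (eval-combine ((u + v) * (u + v)) (u + v) (- (u * v)) (numW u v (suc n)) (numW u v n) w)
          (negate-last ((u + v) * (u + v) + w * (u + v)) w (u * v) (num (suc n) u v w) (num n u v w))
    where
    negate-last : ∀ a w c P Q → a * P + w * w * - c * Q ≡ a * P - w * w * c * Q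
    negate-last = solve-∀

  num-cassini : ∀ n u v w → num (suc (suc n)) u v w * num n u v w - num (suc n) u v w * num (suc n) u v w
                            ≡ (w * w * (u * v)) ^ n * ((u + v) * (u + v) * (v * w))
  num-cassini n u v w =
    trans (cassini (λ k → num k u v w) ((u + v) * (u + v) + w * (u + v)) (w * w * (u * v)) (λ k → num-recurrence k u v w) n)
          (cong ((w * w * (u * v)) ^ n *_) initial)
    where
    initial : num 2 u v w * num 0 u v w - num 1 u v w * num 1 u v w ≡ (u + v) * (u + v) * (v * w)
    initial = begin
      num 2 u v w * num 0 u v w - num 1 u v w * num 1 u v w
        ≡⟨ cong (λ e → e * num 0 u v w - num 1 u v w * num 1 u v w) (num-recurrence 0 u v w) ⟩
      (((u + v) * (u + v) + w * (u + v)) * ((u + v) * (u + v) + w * (u + w * 0ℤ)) - w * w * (u * v) * (1ℤ + w * 0ℤ))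
        * (1ℤ + w * 0ℤ) - ((u + v) * (u + v) + w * (u + w * 0ℤ)) * ((u + v) * (u + v) + w * (u + w * 0ℤ))
        ≡⟨ solve (u ∷ v ∷ w ∷ []) ⟩
      (u + v) * (u + v) * (v * w) ∎

module SternBrocot where

  open import Data.Nat using (ℕ; zero; suc; _+_; _*_)
  import Data.Nat.Properties as ℕ
  open import Data.Nat.Tactic.RingSolver using (solve-∀)
  open import Data.List using (List; []; _∷_; _++_; foldr; replicate; length)
  import Data.List.Properties as List
  open import Data.Product using (∃₂; ∃-syntax; _,_)
  open import Data.Product.Properties using (×-≡,≡→≡)
  open import Data.Empty using (⊥-elim)
  open import Relation.Nullary using (¬_)
  open import Relation.Binary.PropositionalEquality

  -- The reversal used by Defs.walk, so that walk ds = walkFrom root ds holds by definition.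
  reverse′ : List Dir → List Dir
  reverse′ = foldr (λ d acc → acc ++ d ∷ []) []

  walkFrom : Node → List Dir → Node
  walkFrom nd ds = foldr step nd (reverse′ ds)

  walkFrom-∷ : ∀ nd d ds → walkFrom nd (d ∷ ds) ≡ walkFrom (step d nd) ds
  walkFrom-∷ nd d ds = List.foldr-++ step nd (reverse′ ds) (d ∷ [])

  replicate-∷ʳ : ∀ {A : Set} n (x : A) → replicate n x ++ x ∷ [] ≡ x ∷ replicate n x
  replicate-∷ʳ zero    x = refl
  replicate-∷ʳ (suc n) x = cong (x ∷_) (replicate-∷ʳ n x)

  reverse′-replicate : ∀ n d → reverse′ (replicate n d) ≡ replicate n d
  reverse′-replicate zero    d = refl
  reverse′-replicate (suc n) d = trans (cong (_++ d ∷ []) (reverse′-replicate n d)) (replicate-∷ʳ n d)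

  spine : ℕ → Node
  spine j = foldr step (step L root) (replicate j R)

  walk-spine : ∀ j → walk (L ∷ replicate j R) ≡ spine j
  walk-spine j = trans (walkFrom-∷ root L (replicate j R)) (cong (foldr step (step L root)) (reverse′-replicate j R))

  spine-fr : ∀ j → Node.fr (spine j) ≡ (1 , 1)
  spine-fr zero    = refl
  spine-fr (suc j) = spine-fr j

  spine-fm : ∀ j → Node.fm (spine j) ≡ (suc j , suc (suc j))
  spine-fm zero    = refl
  spine-fm (suc j) = begin
    Node.fm (spine j) +F Node.fr (spine j)  ≡⟨ cong₂ _+F_ (spine-fm j) (spine-fr j) ⟩
    (suc j + 1 , suc (suc j) + 1)           ≡⟨ ×-≡,≡→≡ (ℕ.+-comm (suc j) 1 , ℕ.+-comm (suc (suc j)) 1) ⟩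
    (suc (suc j) , suc (suc (suc j)))       ∎
    where open ≡-Reasoning

  fracAt-spine : ∀ j → fracAt (L ∷ replicate j R) ≡ (suc j , suc (suc j))
  fracAt-spine j = trans (cong Node.fm (walk-spine j)) (spine-fm j)

  infixr 25 _·F_

  _·F_ : ℕ → Frac → Frac
  k ·F (p , q) = (k * p , k * q)

  ·F-+F-left : ∀ a b l r → a ·F l +F b ·F (l +F r) ≡ (a + b) ·F l +F b ·F r
  ·F-+F-left a b (p , q) (s , t) = ×-≡,≡→≡ (shuffle a b p s , shuffle a b q t)
    where
    shuffle : ∀ a b p s → a * p + b * (p + s) ≡ (a + b) * p + b * s
    shuffle = solve-∀

  ·F-+F-right : ∀ a b l r → a ·F (l +F r) +F b ·F r ≡ a ·F l +F (a + b) ·F r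
  ·F-+F-right a b (p , q) (s , t) = ×-≡,≡→≡ (shuffle a b p s , shuffle a b q t)
    where
    shuffle : ∀ a b p s → a * (p + s) + b * s ≡ a * p + (a + b) * s
    shuffle = solve-∀

  walkFrom-between : ∀ ds nd → Node.fm nd ≡ Node.fl nd +F Node.fr nd →
    ∃₂ λ α β → Node.fm (walkFrom nd ds) ≡ suc α ·F Node.fl nd +F suc β ·F Node.fr nd
  walkFrom-between [] nd mediant = 0 , 0 , trans mediant (unit (Node.fl nd) (Node.fr nd))
    where
    unit : ∀ l r → l +F r ≡ 1 ·F l +F 1 ·F r
    unit (p , q) (s , t) = ×-≡,≡→≡ (shuffle p s , shuffle q t)
      where
      shuffle : ∀ p s → p + s ≡ 1 * p + 1 * s
      shuffle = solve-∀
  walkFrom-between (L ∷ ds) nd mediant with walkFrom-between ds (step L nd) refl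
  ... | α , β , eq = α + suc β , β , (begin
    Node.fm (walkFrom nd (L ∷ ds))                                       ≡⟨ cong Node.fm (walkFrom-∷ nd L ds) ⟩
    Node.fm (walkFrom (step L nd) ds)                                    ≡⟨ eq ⟩
    suc α ·F Node.fl nd +F suc β ·F Node.fm nd
      ≡⟨ cong (λ m → suc α ·F Node.fl nd +F suc β ·F m) mediant ⟩
    suc α ·F Node.fl nd +F suc β ·F (Node.fl nd +F Node.fr nd)           ≡⟨ ·F-+F-left (suc α) (suc β) (Node.fl nd) (Node.fr nd) ⟩
    suc (α + suc β) ·F Node.fl nd +F suc β ·F Node.fr nd                 ∎)
    where open ≡-Reasoning
  walkFrom-between (R ∷ ds) nd mediant with walkFrom-between ds (step R nd) refl
  ... | α , β , eq = α , α + suc β , (begin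
    Node.fm (walkFrom nd (R ∷ ds))                                       ≡⟨ cong Node.fm (walkFrom-∷ nd R ds) ⟩
    Node.fm (walkFrom (step R nd) ds)                                    ≡⟨ eq ⟩
    suc α ·F Node.fm nd +F suc β ·F Node.fr nd
      ≡⟨ cong (λ m → suc α ·F m +F suc β ·F Node.fr nd) mediant ⟩
    suc α ·F (Node.fl nd +F Node.fr nd) +F suc β ·F Node.fr nd           ≡⟨ ·F-+F-right (suc α) (suc β) (Node.fl nd) (Node.fr nd) ⟩
    suc α ·F Node.fl nd +F suc (α + suc β) ·F Node.fr nd                 ∎)
    where open ≡-Reasoning

  Consecutive : Frac → Set
  Consecutive (p , q) = q ≡ suc p

  Consecutive-+F-1/1 : ∀ f → Consecutive f → Consecutive (f +F (1 , 1))
  Consecutive-+F-1/1 (p , q) q≡1+p = cong (_+ 1) q≡1+p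

  between-consecutive-¬consecutive : ∀ α β l r → Consecutive l → Consecutive r →
    ¬ Consecutive (suc α ·F l +F suc β ·F r)
  between-consecutive-¬consecutive α β (p , _) (s , _) refl refl eq =
    ℕ.m≢1+m+n N (ℕ.suc-injective (trans (sym eq) (expand α β p s)))
    where
    N = suc α * p + suc β * s
    expand : ∀ α β p s → suc α * suc p + suc β * suc s ≡ suc (suc (suc α * p + suc β * s + (α + β)))
    expand = solve-∀

  mediant-consecutive : ∀ nd → Consecutive (Node.fl nd) → Node.fr nd ≡ (1 , 1) → Node.fm nd ≡ Node.fl nd +F Node.fr nd →
    Consecutive (Node.fm nd)
  mediant-consecutive nd l-con r≡1/1 mediant =
    subst Consecutive (sym (trans mediant (cong (Node.fl nd +F_) r≡1/1))) (Consecutive-+F-1/1 (Node.fl nd) l-con)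

  consecutive⇒spine : ∀ ds nd → Consecutive (Node.fl nd) → Node.fr nd ≡ (1 , 1) → Node.fm nd ≡ Node.fl nd +F Node.fr nd →
    Consecutive (Node.fm (walkFrom nd ds)) → ds ≡ replicate (length ds) R
  consecutive⇒spine []       nd _     _     _       _           = refl
  consecutive⇒spine (L ∷ ds) nd l-con r≡1/1 mediant consecutive with walkFrom-between ds (step L nd) refl
  ... | α , β , eq = ⊥-elim (between-consecutive-¬consecutive α β (Node.fl nd) (Node.fm nd)
                              l-con (mediant-consecutive nd l-con r≡1/1 mediant)
                              (subst Consecutive (trans (cong Node.fm (walkFrom-∷ nd L ds)) eq) consecutive))
  consecutive⇒spine (R ∷ ds) nd l-con r≡1/1 mediant consecutive =
    cong (R ∷_) (consecutive⇒spine ds (step R nd) (mediant-consecutive nd l-con r≡1/1 mediant) r≡1/1 refl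
                                   (subst Consecutive (cong Node.fm (walkFrom-∷ nd R ds)) consecutive))

  right-of-root-¬consecutive : ∀ α β → ¬ Consecutive (suc α ·F (1 , 1) +F suc β ·F (1 , 0))
  right-of-root-¬consecutive α β eq =
    ℕ.m≢1+m+n (suc α) (trans (sym (numerator α β)) (trans eq (cong suc (denominator α β))))
    where
    numerator : ∀ α β → suc α * 1 + suc β * 0 ≡ suc α
    numerator = solve-∀
    denominator : ∀ α β → suc α * 1 + suc β * 1 ≡ suc α + suc β
    denominator = solve-∀

  consecutive⇒spine-path : ∀ ds → Consecutive (fracAt ds) → ∃[ j ] ds ≡ L ∷ replicate j R
  consecutive⇒spine-path []       ()
  consecutive⇒spine-path (L ∷ ds) consecutive =
    length ds , cong (L ∷_) (consecutive⇒spine ds (step L root) refl refl refl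
                               (subst Consecutive (cong Node.fm (walkFrom-∷ root L ds)) consecutive))
  consecutive⇒spine-path (R ∷ ds) consecutive with walkFrom-between ds (step R root) refl
  ... | α , β , eq = ⊥-elim (right-of-root-¬consecutive α β
                              (subst Consecutive (trans (cong Node.fm (walkFrom-∷ root R ds)) eq) consecutive))

module MarkovValues where

  open Evaluation
  open Numerators
  open SternBrocot using (spine)
  open import Data.Nat as ℕ using (ℕ; zero; suc)
  open import Data.Integer using (ℤ; +[1+_]; _+_; _-_; _*_; _^_; 0ℤ; 1ℤ; Positive)
  import Data.Integer.Properties as ℤ
  open import Data.Integer.Tactic.RingSolver using (solve-∀; solve)
  open import Data.List using ([]; _∷_; foldr; replicate)
  open import Data.Product using (_×_; _,_; proj₁; proj₂)
  open import Relation.Binary.PropositionalEquality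
  open ≡-Reasoning

  markov-step-algebra : ∀ x y z μ p₀ p₁ p₂ nA dA nB dB nC dC →
    nA * μ ≡ p₀ * x * dA →
    nB * (x * y * (z * z) * μ) ≡ p₁ * x * dB →
    nC * z ≡ (x * x + y * y) * dC →
    p₂ * p₀ - p₁ * p₁ ≡ μ * μ * ((x * x + y * y) * (x * x + y * y) * (y * y * (z * z))) →
    (nB * nB * (dC * dC) + nC * nC * (dB * dB)) * dA * (x * y * (z * z) * (x * y * (z * z) * μ)) * μ
      ≡ p₂ * x * (dB * dB * (dC * dC) * nA) * μ
  markov-step-algebra x y z μ p₀ p₁ p₂ nA dA nB dB nC dC hA hB hC cas = sym (begin
    p₂ * x * (dB * dB * (dC * dC) * nA) * μ
      ≡⟨ solve (p₂ ∷ x ∷ dB ∷ dC ∷ nA ∷ μ ∷ []) ⟩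
    p₂ * x * (dB * dB * (dC * dC)) * (nA * μ)
      ≡⟨ cong (λ e → p₂ * x * (dB * dB * (dC * dC)) * e) hA ⟩
    p₂ * x * (dB * dB * (dC * dC)) * (p₀ * x * dA)
      ≡⟨ solve (p₀ ∷ p₁ ∷ p₂ ∷ x ∷ dB ∷ dC ∷ dA ∷ []) ⟩
    (p₂ * p₀ - p₁ * p₁) * (x * x * (dB * dB) * (dC * dC) * dA) + (p₁ * x * dB) * (p₁ * x * dB) * (dC * dC * dA)
      ≡⟨ cong₂ (λ e f → e * (x * x * (dB * dB) * (dC * dC) * dA) + f * f * (dC * dC * dA)) cas (sym hB) ⟩
    μ * μ * ((x * x + y * y) * (x * x + y * y) * (y * y * (z * z))) * (x * x * (dB * dB) * (dC * dC) * dA)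
      + (nB * (x * y * (z * z) * μ)) * (nB * (x * y * (z * z) * μ)) * (dC * dC * dA)
      ≡⟨ solve (x ∷ y ∷ z ∷ μ ∷ nB ∷ dB ∷ dC ∷ dA ∷ []) ⟩
    ((x * x + y * y) * dC) * ((x * x + y * y) * dC) * (μ * μ * (x * x) * (y * y) * (z * z) * (dB * dB) * dA)
      + (nB * (x * y * (z * z) * μ)) * (nB * (x * y * (z * z) * μ)) * (dC * dC * dA)
      ≡⟨ cong (λ e → e * e * (μ * μ * (x * x) * (y * y) * (z * z) * (dB * dB) * dA)
                     + (nB * (x * y * (z * z) * μ)) * (nB * (x * y * (z * z) * μ)) * (dC * dC * dA)) (sym hC) ⟩
    (nC * z) * (nC * z) * (μ * μ * (x * x) * (y * y) * (z * z) * (dB * dB) * dA)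
      + (nB * (x * y * (z * z) * μ)) * (nB * (x * y * (z * z) * μ)) * (dC * dC * dA)
      ≡⟨ solve (x ∷ y ∷ z ∷ μ ∷ nB ∷ dB ∷ nC ∷ dC ∷ dA ∷ []) ⟩
    (nB * nB * (dC * dC) + nC * nC * (dB * dB)) * dA * (x * y * (z * z) * (x * y * (z * z) * μ)) * μ ∎)

  positive-* : ∀ {i j} → Positive i → Positive j → Positive (i * j)
  positive-* {+[1+ _ ]} {+[1+ _ ]} _ _ = _

  positive-+ : ∀ {i j} → Positive i → Positive j → Positive (i + j)
  positive-+ {+[1+ _ ]} {+[1+ _ ]} _ _ = _

  positive-^ : ∀ {i} n → Positive i → Positive (i ^ n)
  positive-^ zero    _  = _
  positive-^ (suc n) i⁺ = positive-* i⁺ (positive-^ n i⁺)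

  *-cancelʳ-positive : ∀ i j {k} → Positive k → i * k ≡ j * k → i ≡ j
  *-cancelʳ-positive i j {+[1+ n ]} _ = ℤ.*-cancelʳ-≡ i j +[1+ n ]

  ^-distribʳ-* : ∀ i j n → (i * j) ^ n ≡ i ^ n * j ^ n
  ^-distribʳ-* i j zero    = refl
  ^-distribʳ-* i j (suc n) = trans (cong (i * j *_) (^-distribʳ-* i j n)) (interchange i j (i ^ n) (j ^ n))
    where
    interchange : ∀ a b c d → a * b * (c * d) ≡ a * c * (b * d)
    interchange = solve-∀

  exchange : RatFun → RatFun → RatFun → RatFun
  exchange A B C = divR (addR (sqR B) (sqR C)) A

  module AtPoint (x y z : ℤ) (x⁺ : Positive x) (y⁺ : Positive y) (z⁺ : Positive z) where

    E : Poly → ℤ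
    E q = ⟦ q ⟧ x y z

    E-⊗ : ∀ q r → E (q ⊗ r) ≡ E q * E r
    E-⊗ = ⟦⟧-⊗ x y z

    m : ℤ
    m = x * y * (z * z)

    p : ℕ → ℤ
    p k = num k (x * x) (y * y) (z * z)

    infix 4 _≐_/_

    _≐_/_ : RatFun → ℤ → ℤ → Set
    (N , D) ≐ r / s = E N * s ≡ r * E D

    E-exchange-numerator : ∀ nA dA nB dB nC dC →
      E (proj₁ (exchange (nA , dA) (nB , dB) (nC , dC))) ≡ (E nB * E nB * (E dC * E dC) + E nC * E nC * (E dB * E dB)) * E dA
    E-exchange-numerator nA dA nB dB nC dC = begin
      E ((nB ⊗ nB ⊗ (dC ⊗ dC) ⊕ nC ⊗ nC ⊗ (dB ⊗ dB)) ⊗ dA)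
        ≡⟨ E-⊗ (nB ⊗ nB ⊗ (dC ⊗ dC) ⊕ nC ⊗ nC ⊗ (dB ⊗ dB)) dA ⟩
      E (nB ⊗ nB ⊗ (dC ⊗ dC) ⊕ nC ⊗ nC ⊗ (dB ⊗ dB)) * E dA
        ≡⟨ cong (_* E dA) (⟦⟧-⊕ x y z (nB ⊗ nB ⊗ (dC ⊗ dC)) (nC ⊗ nC ⊗ (dB ⊗ dB))) ⟩
      (E (nB ⊗ nB ⊗ (dC ⊗ dC)) + E (nC ⊗ nC ⊗ (dB ⊗ dB))) * E dA
        ≡⟨ cong (_* E dA) (cong₂ _+_ (square-product nB dC) (square-product nC dB)) ⟩
      (E nB * E nB * (E dC * E dC) + E nC * E nC * (E dB * E dB)) * E dA ∎
      where
      square-product : ∀ q r → E (q ⊗ q ⊗ (r ⊗ r)) ≡ E q * E q * (E r * E r)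
      square-product q r = trans (E-⊗ (q ⊗ q) (r ⊗ r)) (cong₂ _*_ (E-⊗ q q) (E-⊗ r r))

    E-exchange-denominator : ∀ nA dA nB dB nC dC →
      E (proj₂ (exchange (nA , dA) (nB , dB) (nC , dC))) ≡ E dB * E dB * (E dC * E dC) * E nA
    E-exchange-denominator nA dA nB dB nC dC =
      trans (E-⊗ (dB ⊗ dB ⊗ (dC ⊗ dC)) nA)
            (cong (_* E nA) (trans (E-⊗ (dB ⊗ dB) (dC ⊗ dC)) (cong₂ _*_ (E-⊗ dB dB) (E-⊗ dC dC))))

    PositiveR : RatFun → Set
    PositiveR (N , D) = Positive (E N) × Positive (E D)

    exchange-positive : ∀ A B C → PositiveR A → PositiveR B → PositiveR C → PositiveR (exchange A B C)
    exchange-positive (nA , dA) (nB , dB) (nC , dC) (nA⁺ , dA⁺) (nB⁺ , dB⁺) (nC⁺ , dC⁺) =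
      subst Positive (sym (E-exchange-numerator nA dA nB dB nC dC))
        (positive-* (positive-+ (positive-* (positive-* nB⁺ nB⁺) (positive-* dC⁺ dC⁺))
                                (positive-* (positive-* nC⁺ nC⁺) (positive-* dB⁺ dB⁺))) dA⁺) ,
      subst Positive (sym (E-exchange-denominator nA dA nB dB nC dC))
        (positive-* (positive-* (positive-* dB⁺ dB⁺) (positive-* dC⁺ dC⁺)) nA⁺)

    PositiveNode : Node → Set
    PositiveNode nd = PositiveR (Node.Ml nd) × PositiveR (Node.Mm nd) × PositiveR (Node.Mr nd)

    step-positive : ∀ d nd → PositiveNode nd → PositiveNode (step d nd)
    step-positive L nd (l⁺ , m⁺ , r⁺) = l⁺ , exchange-positive (Node.Mr nd) (Node.Ml nd) (Node.Mm nd) r⁺ l⁺ m⁺ , m⁺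
    step-positive R nd (l⁺ , m⁺ , r⁺) = m⁺ , exchange-positive (Node.Ml nd) (Node.Mm nd) (Node.Mr nd) l⁺ m⁺ r⁺ , r⁺

    E-X : E X ≡ x
    E-X = begin
      1ℤ * (x * 1ℤ) * 1ℤ * 1ℤ + 0ℤ  ≡⟨ solve (x ∷ []) ⟩
      x                            ∎

    E-Y : E Y ≡ y
    E-Y = begin
      1ℤ * 1ℤ * (y * 1ℤ) * 1ℤ + 0ℤ  ≡⟨ solve (y ∷ []) ⟩
      y                            ∎

    E-Z : E Z ≡ z
    E-Z = begin
      1ℤ * 1ℤ * 1ℤ * (z * 1ℤ) + 0ℤ  ≡⟨ solve (z ∷ []) ⟩
      z                            ∎

    E-X²+Y² : E (X ⊗ X ⊕ Y ⊗ Y) ≡ x * x + y * y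
    E-X²+Y² = begin
      E (X ⊗ X ⊕ Y ⊗ Y)          ≡⟨ ⟦⟧-⊕ x y z (X ⊗ X) (Y ⊗ Y) ⟩
      E (X ⊗ X) + E (Y ⊗ Y)      ≡⟨ cong₂ _+_ (E-⊗ X X) (E-⊗ Y Y) ⟩
      E X * E X + E Y * E Y      ≡⟨ cong₂ (λ s t → s * s + t * t) E-X E-Y ⟩
      x * x + y * y              ∎

    root-positive : PositiveNode root
    root-positive = (subst Positive (sym E-X) x⁺ , _) ,
                    (subst Positive (sym E-X²+Y²) (positive-+ (positive-* x⁺ x⁺) (positive-* y⁺ y⁺)) ,
                     subst Positive (sym E-Z) z⁺) ,
                    (subst Positive (sym E-Y) y⁺ , _)

    markov-cassini : ∀ k → p (suc (suc k)) * p k - p (suc k) * p (suc k)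
                           ≡ m ^ k * m ^ k * ((x * x + y * y) * (x * x + y * y) * (y * y * (z * z)))
    markov-cassini k = begin
      p (suc (suc k)) * p k - p (suc k) * p (suc k)
        ≡⟨ num-cassini k (x * x) (y * y) (z * z) ⟩
      (z * z * (z * z) * (x * x * (y * y))) ^ k * ((x * x + y * y) * (x * x + y * y) * (y * y * (z * z)))
        ≡⟨ cong (λ e → e ^ k * ((x * x + y * y) * (x * x + y * y) * (y * y * (z * z)))) w²uv≡m² ⟩
      (m * m) ^ k * ((x * x + y * y) * (x * x + y * y) * (y * y * (z * z)))
        ≡⟨ cong (_* ((x * x + y * y) * (x * x + y * y) * (y * y * (z * z)))) (^-distribʳ-* m m k) ⟩
      m ^ k * m ^ k * ((x * x + y * y) * (x * x + y * y) * (y * y * (z * z))) ∎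
      where
      w²uv≡m² : z * z * (z * z) * (x * x * (y * y)) ≡ x * y * (z * z) * (x * y * (z * z))
      w²uv≡m² = solve (x ∷ y ∷ z ∷ [])

    markov-step : ∀ {k} A B C → A ≐ p k * x / m ^ k → B ≐ p (suc k) * x / m ^ suc k → C ≐ (x * x + y * y) / z →
      exchange A B C ≐ p (suc (suc k)) * x / m ^ suc (suc k)
    markov-step {k} (nA , dA) (nB , dB) (nC , dC) hA hB hC = *-cancelʳ-positive _ _ (positive-^ k m⁺) (begin
      E N * m ^ suc (suc k) * m ^ k
        ≡⟨ cong (λ e → e * m ^ suc (suc k) * m ^ k) (E-exchange-numerator nA dA nB dB nC dC) ⟩
      (E nB * E nB * (E dC * E dC) + E nC * E nC * (E dB * E dB)) * E dA * m ^ suc (suc k) * m ^ k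
        ≡⟨ markov-step-algebra x y z (m ^ k) (p k) (p (suc k)) (p (suc (suc k))) (E nA) (E dA) (E nB) (E dB) (E nC) (E dC)
                               hA hB hC (markov-cassini k) ⟩
      p (suc (suc k)) * x * (E dB * E dB * (E dC * E dC) * E nA) * m ^ k
        ≡⟨ cong (λ e → p (suc (suc k)) * x * e * m ^ k) (E-exchange-denominator nA dA nB dB nC dC) ⟨
      p (suc (suc k)) * x * E D * m ^ k ∎)
      where
      N = proj₁ (exchange (nA , dA) (nB , dB) (nC , dC))
      D = proj₂ (exchange (nA , dA) (nB , dB) (nC , dC))
      m⁺ : Positive m
      m⁺ = positive-* (positive-* x⁺ y⁺) (positive-* z⁺ z⁺)

    SpineValues : ℕ → Node → Set
    SpineValues k nd = (Node.Ml nd ≐ p k * x / m ^ k)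
                     × (Node.Mm nd ≐ p (suc k) * x / m ^ suc k)
                     × (Node.Mr nd ≐ (x * x + y * y) / z)

    spine-values : ∀ j → SpineValues j (spine j)
    spine-values zero = M₀/₁ , M₁/₂ , M₁/₁
      where
      M₀/₁ : (X , one) ≐ p 0 * x / m ^ 0
      M₀/₁ = begin
        E X * 1ℤ                   ≡⟨ cong (_* 1ℤ) E-X ⟩
        x * 1ℤ                     ≡⟨ solve (x ∷ z ∷ []) ⟩
        (1ℤ + z * z * 0ℤ) * x * 1ℤ ∎
      M₁/₁ : (X ⊗ X ⊕ Y ⊗ Y , Z) ≐ (x * x + y * y) / z
      M₁/₁ = trans (cong (_* z) E-X²+Y²) (cong ((x * x + y * y) *_) (sym E-Z))
      M₁/₂ : exchange (Y , one) (X , one) (X ⊗ X ⊕ Y ⊗ Y , Z) ≐ p 1 * x / m ^ 1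
      M₁/₂ = begin
        E (proj₁ (exchange (Y , one) (X , one) (X ⊗ X ⊕ Y ⊗ Y , Z))) * (m * 1ℤ)
          ≡⟨ cong (_* (m * 1ℤ)) (E-exchange-numerator Y one X one (X ⊗ X ⊕ Y ⊗ Y) Z) ⟩
        (E X * E X * (E Z * E Z) + E (X ⊗ X ⊕ Y ⊗ Y) * E (X ⊗ X ⊕ Y ⊗ Y) * (1ℤ * 1ℤ)) * 1ℤ * (m * 1ℤ)
          ≡⟨ cong₂ (λ s t → (s * s * (E Z * E Z) + t * t * (1ℤ * 1ℤ)) * 1ℤ * (m * 1ℤ)) E-X E-X²+Y² ⟩
        (x * x * (E Z * E Z) + (x * x + y * y) * (x * x + y * y) * (1ℤ * 1ℤ)) * 1ℤ * (m * 1ℤ)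
          ≡⟨ cong (λ s → (x * x * (s * s) + (x * x + y * y) * (x * x + y * y) * (1ℤ * 1ℤ)) * 1ℤ * (m * 1ℤ)) E-Z ⟩
        (x * x * (z * z) + (x * x + y * y) * (x * x + y * y) * (1ℤ * 1ℤ)) * 1ℤ * (x * y * (z * z) * 1ℤ)
          ≡⟨ solve (x ∷ y ∷ z ∷ []) ⟩
        ((x * x + y * y) * (x * x + y * y) + z * z * (x * x + z * z * 0ℤ)) * x * (1ℤ * 1ℤ * (z * z) * y)
          ≡⟨ cong₂ (λ s t → p 1 * x * (1ℤ * 1ℤ * (s * s) * t)) E-Z E-Y ⟨
        p 1 * x * (1ℤ * 1ℤ * (E Z * E Z) * E Y)
          ≡⟨ cong (p 1 * x *_) (E-exchange-denominator Y one X one (X ⊗ X ⊕ Y ⊗ Y) Z) ⟨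
        p 1 * x * E (proj₂ (exchange (Y , one) (X , one) (X ⊗ X ⊕ Y ⊗ Y , Z))) ∎
    spine-values (suc j) with spine-values j
    ... | l , mm , r = mm , markov-step {j} (Node.Ml (spine j)) (Node.Mm (spine j)) (Node.Mr (spine j)) l mm r , r

    foldr-step-positive : ∀ ds nd → PositiveNode nd → PositiveNode (foldr step nd ds)
    foldr-step-positive []       nd nd⁺ = nd⁺
    foldr-step-positive (d ∷ ds) nd nd⁺ = step-positive d (foldr step nd ds) (foldr-step-positive ds nd nd⁺)

    spine-monomial : ∀ j → x ^ j * y ^ suc j * z ^ (j ℕ.+ suc (suc j)) * x ≡ m ^ suc j
    spine-monomial j = begin
      x ^ j * y ^ suc j * z ^ (j ℕ.+ suc (suc j)) * x
        ≡⟨ cong (λ e → x ^ j * y ^ suc j * e * x) (ℤ.^-distribˡ-+-* z j (suc (suc j))) ⟩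
      x ^ j * (y * y ^ j) * (z ^ j * (z * (z * z ^ j))) * x
        ≡⟨ regroup x y z (x ^ j) (y ^ j) (z ^ j) ⟩
      m * (x ^ j * y ^ j * (z ^ j * z ^ j))
        ≡⟨ cong (m *_) m^j ⟨
      m * m ^ j ∎
      where
      m^j : m ^ j ≡ x ^ j * y ^ j * (z ^ j * z ^ j)
      m^j = trans (^-distribʳ-* (x * y) (z * z) j) (cong₂ _*_ (^-distribʳ-* x y j) (^-distribʳ-* z z j))
      regroup : ∀ x y z a b c → a * (y * b) * (c * (z * (z * c))) * x ≡ x * y * (z * z) * (a * b * (c * c))
      regroup = solve-∀

    spine-numerator-value : ∀ j P → IsNumerator (suc j) (suc (suc j)) (Node.Mm (spine j)) P →
      ⟦ P ⟧ (x * x) (y * y) (z * z) ≡ p (suc j)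
    spine-numerator-value j P isNum = *-cancelʳ-positive _ _ (positive-* D⁺ x⁺) (begin
      ⟦ P ⟧ (x * x) (y * y) (z * z) * (E D * x)
        ≡⟨ ℤ.*-assoc (⟦ P ⟧ (x * x) (y * y) (z * z)) (E D) x ⟨
      ⟦ P ⟧ (x * x) (y * y) (z * z) * E D * x
        ≡⟨ cong (λ e → e * E D * x) (⟦⟧-squareVars x y z P) ⟨
      E (squareVars P) * E D * x
        ≡⟨ cong (_* x) (E-⊗ (squareVars P) D) ⟨
      E (squareVars P ⊗ D) * x
        ≡⟨ cong (_* x) (≈⇒⟦⟧≡ {squareVars P ⊗ D} {N ⊗ mono j (suc j) (j ℕ.+ suc (suc j))} isNum x y z) ⟩
      E (N ⊗ mono j (suc j) (j ℕ.+ suc (suc j))) * x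
        ≡⟨ cong (_* x) (trans (E-⊗ N (mono j (suc j) (j ℕ.+ suc (suc j))))
                              (cong (E N *_) (⟦⟧-mono x y z j (suc j) (j ℕ.+ suc (suc j))))) ⟩
      E N * (x ^ j * y ^ suc j * z ^ (j ℕ.+ suc (suc j))) * x
        ≡⟨ ℤ.*-assoc (E N) _ x ⟩
      E N * (x ^ j * y ^ suc j * z ^ (j ℕ.+ suc (suc j)) * x)
        ≡⟨ cong (E N *_) (spine-monomial j) ⟩
      E N * m ^ suc j
        ≡⟨ proj₁ (proj₂ (spine-values j)) ⟩
      p (suc j) * x * E D
        ≡⟨ swap (p (suc j)) x (E D) ⟩
      p (suc j) * (E D * x) ∎)
      where
      N = proj₁ (Node.Mm (spine j))
      D = proj₂ (Node.Mm (spine j))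
      D⁺ : Positive (E D)
      D⁺ = proj₂ (proj₁ (proj₂ (foldr-step-positive (replicate j R) (step L root) (step-positive L root root-positive))))
      swap : ∀ a b c → a * b * c ≡ a * (c * b)
      swap = solve-∀

module CoefficientExtraction where

  open CoefficientLists
  open Evaluation
  open Numerators
  open import Data.Nat as ℕ using (ℕ; suc; _≤_; _<_; s≤s)
  import Data.Nat.Properties as ℕ
  open import Data.Integer using (ℤ; +_; _+_; _*_; _^_)
  open import Data.List using (List)
  open import Relation.Binary.PropositionalEquality
  open ≡-Reasoning

  module FromValues (P : Poly) (n : ℕ)
    (agree : ∀ a b c → ⟦ P ⟧ (sq a) (sq b) (sq c) ≡ num n (sq a) (sq b) (sq c)) where

    d : ℕ
    d = bound P ℕ.⊔ suc n

    <d : ∀ {i} → i ≤ n → i < d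
    <d i≤n = ℕ.≤-trans (s≤s i≤n) (ℕ.m≤n⊔m (bound P) (suc n))

    [w^_]P : ℕ → ℤ → ℤ → ℤ
    [w^ k ]P u v = series d (λ j → series d (λ i → coeff P i j k) u) v

    [v^_w^_]P : ℕ → ℕ → ℤ → ℤ
    [v^ j w^ k ]P u = series d (λ i → coeff P i j k) u

    [w^]P≡‼numW : ∀ {k} → k ≤ n → ∀ a b → [w^ k ]P (sq a) (sq b) ≡ numW (sq a) (sq b) n ‼ k
    [w^]P≡‼numW k≤n a b = coefficient-from-squares d (λ k → [w^ k ]P (sq a) (sq b)) (numW (sq a) (sq b) n) (<d k≤n)
      (λ t → trans (sym (expansion P (ℕ.m≤m⊔n (bound P) (suc n)) (sq a) (sq b) (sq t))) (agree a b t))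

    [v^w^]P≡‼ : ∀ {j k} (cs : ℤ → List ℤ) → j ≤ n →
      (∀ a b → [w^ k ]P (sq a) (sq b) ≡ eval (cs (sq a)) (sq b)) → ∀ a → [v^ j w^ k ]P (sq a) ≡ cs (sq a) ‼ j
    [v^w^]P≡‼ {k = k} cs j≤n [w^k]P≡ a =
      coefficient-from-squares d (λ j → [v^ j w^ k ]P (sq a)) (cs (sq a)) (<d j≤n) ([w^k]P≡ a)

    coeff≡ : ∀ {i j k} c → i ≤ n → (∀ a → [v^ j w^ k ]P (sq a) ≡ c * sq a ^ i) → coeff P i j k ≡ c
    coeff≡ {i} {j} {k} c i≤n [v^jw^k]P≡ = trans
      (coefficient-from-squares d (λ i → coeff P i j k) (monomial i c) (<d i≤n)
        (λ a → trans ([v^jw^k]P≡ a) (sym (eval-monomial i c (sq a)))))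
      (‼-monomial i c)

  numerator-coefficient : ∀ r m (P : Poly) →
    (∀ a b c → ⟦ P ⟧ (sq a) (sq b) (sq c) ≡ num (suc (suc (r ℕ.+ m))) (sq a) (sq b) (sq c)) →
    coeff P (suc m) (suc (suc r)) (suc (r ℕ.+ m)) ≡ + (4 ℕ.* suc m)
  numerator-coefficient r m P agree =
    coeff≡ (+ (4 ℕ.* suc m)) (s≤s (ℕ.≤-trans (ℕ.m≤n+m m r) (ℕ.n≤1+n (r ℕ.+ m))))
      (λ a → trans ([v^w^]P≡‼ (λ u → u +X· u +X· Q u n) (s≤s (s≤s (ℕ.m≤m+n r m))) [w^n-1]P≡ a)
                   (‼-square-Q (sq a) r m))
    where
    n = suc (suc (r ℕ.+ m))
    open FromValues P n agree
    [w^n-1]P≡ : ∀ a b → [w^ suc (r ℕ.+ m) ]P (sq a) (sq b) ≡ eval (sq a +X· sq a +X· Q (sq a) n) (sq b)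
    [w^n-1]P≡ a b = begin
      [w^ suc (r ℕ.+ m) ]P (sq a) (sq b)                ≡⟨ [w^]P≡‼numW (ℕ.n≤1+n _) a b ⟩
      numW (sq a) (sq b) n ‼ suc (r ℕ.+ m)              ≡⟨ ‼-numW-subtop (sq a) (sq b) (suc (r ℕ.+ m)) ⟩
      (sq a + sq b) * (sq a + sq b) * eval (Q (sq a) n) (sq b)  ≡⟨ eval-+X·-+X· (sq a) (Q (sq a) n) (sq b) ⟨
      eval (sq a +X· sq a +X· Q (sq a) n) (sq b)        ∎

open import Data.Nat using (ℕ; zero; suc; _+_; _*_; _∸_; _≤_; _<_; s≤s)
import Data.Nat.Properties as ℕ
open import Data.Nat.Tactic.RingSolver using (solve-∀)
open import Data.Integer using (+_; +[1+_])
open import Data.List using (List; _∷_; replicate)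
open import Data.Product using (_×_; _,_; proj₁; proj₂; ∃-syntax)
open import Relation.Binary.PropositionalEquality
open CoefficientLists using (sq)
open Evaluation using (⟦_⟧)
open Numerators using (num)
open SternBrocot
open MarkovValues using (module AtPoint)
open CoefficientExtraction using (numerator-coefficient)

numerator-values : ∀ {n} ds → fracAt ds ≡ (n , suc n) → ∀ P → IsNumerator n (suc n) (markovAt ds) P →
  ∀ a b c → ⟦ P ⟧ (sq a) (sq b) (sq c) ≡ num n (sq a) (sq b) (sq c)
numerator-values ds frac P isNum a b c with consecutive⇒spine-path ds (subst Consecutive (sym frac) refl)
... | j , refl with trans (sym (fracAt-spine j)) frac
... | refl = AtPoint.spine-numerator-value +[1+ a ] +[1+ b ] +[1+ c ] _ _ _ j P
               (subst (λ nd → IsNumerator (suc j) (suc (suc j)) (Node.Mm nd) P) (walk-spine j) isNum)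

coefficient-indices : ∀ r m → let n = suc (suc (r + m)) in
  (suc n ∸ suc m ≡ suc (suc r)) × (2 * n ∸ suc m ∸ (suc n ∸ suc m) ≡ suc (r + m))
coefficient-indices r m = upper , (begin
  2 * suc (suc (r + m)) ∸ suc m ∸ (suc (suc (suc (r + m))) ∸ suc m)
    ≡⟨ cong₂ (λ s t → s ∸ suc m ∸ t) (split r m) upper ⟩
  suc m + (suc (suc r) + suc (r + m)) ∸ suc m ∸ suc (suc r)
    ≡⟨ cong (_∸ suc (suc r)) (ℕ.m+n∸m≡n (suc m) _) ⟩
  suc (suc r) + suc (r + m) ∸ suc (suc r)
    ≡⟨ ℕ.m+n∸m≡n (suc (suc r)) _ ⟩
  suc (r + m) ∎)
  where
  open ≡-Reasoning
  upper : suc (suc (suc (r + m))) ∸ suc m ≡ suc (suc r)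
  upper = ℕ.m+n∸n≡m (suc (suc r)) m
  split : ∀ r m → 2 * suc (suc (r + m)) ≡ suc m + (suc (suc r) + suc (r + m))
  split = solve-∀

numerator-coefficients : ∀ n P → (∀ a b c → ⟦ P ⟧ (sq a) (sq b) (sq c) ≡ num n (sq a) (sq b) (sq c)) →
  ∀ m → 1 ≤ m → m < n → coeff P m (suc n ∸ m) (2 * n ∸ m ∸ (suc n ∸ m)) ≡ + (4 * m)
numerator-coefficients (suc (suc k)) P agree (suc m) _ (s≤s (s≤s m≤k)) with k ∸ m | ℕ.m∸n+n≡m m≤k
... | r | refl = trans (cong₂ (coeff P (suc m)) (proj₁ (coefficient-indices r m)) (proj₂ (coefficient-indices r m)))
                       (numerator-coefficient r m P agree)

theorem9p2 : (n : ℕ) → 2 ≤ n →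
    (∃[ ds ] fracAt ds ≡ (n , suc n)) ×
    ((ds : List Dir) → fracAt ds ≡ (n , suc n) →
     (P : Poly) → IsNumerator n (suc n) (markovAt ds) P →
     (m : ℕ) → 1 ≤ m → m < n →
     coeff P m (suc n ∸ m) (2 * n ∸ m ∸ (suc n ∸ m)) ≡ + (4 * m))
theorem9p2 zero    ()
theorem9p2 (suc j) _ =
  (L ∷ replicate j R , fracAt-spine j) ,
  λ ds frac P isNum → numerator-coefficients (suc j) P (numerator-values ds frac P isNum)
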